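{- Let $\alpha$ be a nonzero integer and let $(h_n)$ be the sequence with $h_0=0$, $h_1=1$, $h_2=-\alpha$, $h_3=-\alpha^3$, $h_4=\alpha^6$, and for $m\ge2$: $h_{2m+1}=h_{m+2}h_m^3-h_{m-1}h_{m+1}^3$, for $m\ge 3$: $h_{2m}=h_m\big(h_{m+2}h_{m-1}^2-h_{m-2}h_{m+1}^2\big)/h_2$. (i) If $n\equiv 1,4,6,9\pmod{10}$, then $h_n$ is a square. (ii) If $n\equiv 1,3,4,11,12,14\pmod{15}$, then $h_n$ is a cube.
   Context: The sequence defined is the elliptic divisibility sequence attached to the point $(0,0)$ of order $5$ on $y^2+(1-\alpha)xy-\alpha y=x^3-\alpha x^2$; its fifth term is zero. Convention: an integer $m$ is called a square if $m=\pm\beta^2$ for some nonzero integer $\beta$, and a cube if $m=\beta^3$ for some nonzero integer $\beta$. -}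

module Defs where

open import Data.Nat as ℕ using (ℕ; zero; suc; _∸_; _%_; _/_)
open import Data.Integer as ℤ using (ℤ; +_; -_; _*_; _-_)
open import Data.Integer.DivMod using () renaming (_/_ to _/ℤ_)
open import Data.List using (List; []; _∷_; _++_; [_])
open import Data.Product using (∃; _×_; _,_)
open import Data.Sum using (_⊎_)
open import Relation.Binary.PropositionalEquality using (_≡_; _≢_)

-- total integer division (division by 0 returns 0); only ever used with
-- divisor h₂ = -α ≠ 0, where the division is exact
divℤ : ℤ → ℤ → ℤ
divℤ a (+ zero)    = + 0
divℤ a (+ suc n)   = a /ℤ (+ suc n)
divℤ a (ℤ.-[1+ n ]) = a /ℤ ℤ.-[1+ n ]

get : List ℤ → ℕ → ℤ
get []       _       = + 0
get (x ∷ xs) zero    = x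
get (x ∷ xs) (suc i) = get xs i

-- next α l k : the value h_k computed from l = [h_0, …, h_{k-1}]
next : ℤ → List ℤ → ℕ → ℤ
next α l 0 = + 0
next α l 1 = + 1
next α l 2 = - α
next α l 3 = - (α * α * α)
next α l 4 = α * α * α * α * α * α
next α l k@(suc (suc (suc (suc (suc _))))) with k % 2
... | 1 = let m = k / 2 in
          get l (m ℕ.+ 2) * (get l m * get l m * get l m)
            - get l (m ∸ 1) * (get l (m ℕ.+ 1) * get l (m ℕ.+ 1) * get l (m ℕ.+ 1))
... | _ = let m = k / 2 in
          divℤ (get l m * (get l (m ℕ.+ 2) * (get l (m ∸ 1) * get l (m ∸ 1))
                   - get l (m ∸ 2) * (get l (m ℕ.+ 1) * get l (m ℕ.+ 1))))
               (get l 2)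

hs : ℤ → ℕ → List ℤ
hs α zero    = []
hs α (suc n) = hs α n ++ [ next α (hs α n) n ]

h : ℤ → ℕ → ℤ
h α n = get (hs α (suc n)) n

IsSquare : ℤ → Set
IsSquare m = ∃ λ β → β ≢ + 0 × (m ≡ β * β ⊎ m ≡ - (β * β))

IsCube : ℤ → Set
IsCube m = ∃ λ β → β ≢ + 0 × m ≡ β * β * β

module Submission where

-- Theorem 5.3.  For α ≠ 0 let h be the elliptic divisibility sequence of Defs (the sequence of
-- the 5-torsion point (0,0) on y² + (1−α)xy − αy = x³ − αx²).
--
-- Since (0,0) has order 5, h is periodic up to powers of α:  h (5 + n) = − α^(4n+10) · h n.
-- We therefore work with the explicit sequence g given by h₀, …, h₄ and this rule, and show:
--  * g satisfies both duplication formulas of the recursion.  Raising m by 5 multiplies every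
--    monomial of a formula by one and the same power of α (odd-rescale, even-rescale), so by
--    induction with step 5 only m = 1,…,5 (odd) and m = 2,…,6 (even) must be checked; there
--    the values of g are explicit signed monomials ±αᵉ (the table g₀ … g₁₄).
--  * Consequently the list hs α n of Defs is the list of the first n values of g, so h = g; the
--    division by h₂ = −α in the even formula is exact.
--  * Ten steps multiply g by the square (α^(4n+20))², fifteen steps by the cube (−α^(4n+30))³.
--    Squares resp. cubes at the listed residues (read off the table) thus propagate along the
--    arithmetic progressions n ≡ r, which proves the theorem.

open import Defs
open import Data.Nat using (ℕ; _%_)
open import Data.Integer using (ℤ; +_)
open import Data.Product using (_×_)
open import Data.Sum using (_⊎_)
open import Relation.Binary.PropositionalEquality using (_≡_; _≢_)

open import Data.Nat as ℕ using (zero; suc; _+_; _∸_; _/_; _≤_; _<_; z≤n; s≤s; NonZero)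
import Data.Nat.Properties as ℕP
import Data.Nat.DivMod as ℕD
import Data.Nat.Tactic.RingSolver as ℕSolver
open import Data.Integer as ℤ using (_*_; _-_; -_; _^_; 0ℤ; 1ℤ; -1ℤ)
import Data.Integer.Properties as ℤP
import Data.Integer.DivMod as ℤD
import Data.Integer.Tactic.RingSolver as ℤSolver
open import Data.List using (List; []; _∷_; _++_; [_]; length)
open import Data.List.Properties using (length-++)
open import Data.Product using (_,_)
open import Data.Sum using (inj₁; inj₂)
open import Data.Empty using (⊥-elim)
open import Function using (_∘_)
open import Relation.Binary.PropositionalEquality
  using (refl; sym; trans; cong; cong₂; subst; subst₂; module ≡-Reasoning)

open ≡-Reasoning

induction-mod-5 : (P : ℕ → Set) → P 0 → P 1 → P 2 → P 3 → P 4 →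
                  (∀ n → P n → P (5 + n)) → ∀ n → P n
induction-mod-5 P p₀ p₁ p₂ p₃ p₄ step 0 = p₀
induction-mod-5 P p₀ p₁ p₂ p₃ p₄ step 1 = p₁
induction-mod-5 P p₀ p₁ p₂ p₃ p₄ step 2 = p₂
induction-mod-5 P p₀ p₁ p₂ p₃ p₄ step 3 = p₃
induction-mod-5 P p₀ p₁ p₂ p₃ p₄ step 4 = p₄
induction-mod-5 P p₀ p₁ p₂ p₃ p₄ step (suc (suc (suc (suc (suc n))))) =
  step n (induction-mod-5 P p₀ p₁ p₂ p₃ p₄ step n)

along-progression : (P : ℕ → Set) (d r : ℕ) → (∀ n → P n → P (d + n)) → P r →
                    ∀ q → P (q ℕ.* d + r)
along-progression P d r step base zero    = base
along-progression P d r step base (suc q) =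
  subst P (sym (ℕP.+-assoc d (q ℕ.* d) r)) (step _ (along-progression P d r step base q))

div-mod : ∀ n d .{{_ : NonZero d}} → n ≡ n / d ℕ.* d + n % d
div-mod n d = trans (ℕD.m≡m%n+[m/n]*n n d) (ℕP.+-comm (n % d) (n / d ℕ.* d))

halving : ∀ n → (n % 2 ≡ 0 × n ≡ n / 2 + n / 2) ⊎ (n % 2 ≡ 1 × n ≡ suc (n / 2 + n / 2))
halving n with n % 2 | ℕD.m%n<n n 2 | div-mod n 2
... | 0 | _ | n≡ = inj₁ (refl , trans n≡ (double (n / 2)))
  where
  double : ∀ m → m ℕ.* 2 + 0 ≡ m + m
  double = ℕSolver.solve-∀
... | 1 | _ | n≡ = inj₂ (refl , trans n≡ (double+1 (n / 2)))
  where
  double+1 : ∀ m → m ℕ.* 2 + 1 ≡ suc (m + m)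
  double+1 = ℕSolver.solve-∀
... | suc (suc _) | s≤s (s≤s ()) | _

odd-half-≥2 : ∀ {j} m → 5 + j ≡ suc (m + m) → 2 ≤ m
odd-half-≥2 0 ()
odd-half-≥2 1 ()
odd-half-≥2 (suc (suc m)) _ = s≤s (s≤s z≤n)

even-half-≥3 : ∀ {j} m → 5 + j ≡ m + m → 3 ≤ m
even-half-≥3 0 ()
even-half-≥3 1 ()
even-half-≥3 2 ()
even-half-≥3 (suc (suc (suc m))) _ = s≤s (s≤s (s≤s z≤n))

get-++ˡ : ∀ xs {ys i} → i < length xs → get (xs ++ ys) i ≡ get xs i
get-++ˡ (x ∷ xs) {i = zero}  _          = refl
get-++ˡ (x ∷ xs) {i = suc i} (s≤s i<n) = get-++ˡ xs i<n

get-++-length : ∀ xs ys → get (xs ++ ys) (length xs) ≡ get ys 0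
get-++-length []       ys = refl
get-++-length (x ∷ xs) ys = get-++-length xs ys

*-≢0 : ∀ {x y} → x ≢ 0ℤ → y ≢ 0ℤ → x * y ≢ 0ℤ
*-≢0 {x} x≢0 y≢0 xy≡0 with ℤP.i*j≡0⇒i≡0∨j≡0 x xy≡0
... | inj₁ x≡0 = x≢0 x≡0
... | inj₂ y≡0 = y≢0 y≡0

-≢0 : ∀ {x} → x ≢ 0ℤ → - x ≢ 0ℤ
-≢0 {x} x≢0 -x≡0 = x≢0 (trans (sym (ℤP.neg-involutive x)) (cong -_ -x≡0))

^-≢0 : ∀ {x} → x ≢ 0ℤ → ∀ k → x ^ k ≢ 0ℤ
^-≢0 {x} x≢0 k xᵏ≡0 = x≢0 (ℤP.i^n≡0⇒i≡0 x k xᵏ≡0)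

-- Integer division of an exact multiple: the remainder r satisfies ∣a − q∣·∣b∣ = r < ∣b∣,
-- which forces the quotient q to be a.
/-exact : ∀ a b .{{_ : ℤ.NonZero b}} → (a * b) ℤ./ b ≡ a
/-exact a b = sym (ℤP.i-j≡0⇒i≡j a q (ℤP.∣i∣≡0⇒i≡0 ∣a-q∣≡0))
  where
  q = (a * b) ℤ./ b
  r = (a * b) ℤ.% b
  remainder : (a - q) * b ≡ + r
  remainder = begin
    (a - q) * b         ≡⟨ distrib a q b ⟩
    a * b - q * b       ≡⟨ cong (_- q * b) (ℤD.a≡a%n+[a/n]*n (a * b) b) ⟩
    + r ℤ.+ q * b - q * b ≡⟨ cancel (+ r) (q * b) ⟩
    + r                 ∎
    where
    distrib : ∀ a q b → (a - q) * b ≡ a * b - q * b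
    distrib = ℤSolver.solve-∀
    cancel : ∀ r x → r ℤ.+ x - x ≡ r
    cancel = ℤSolver.solve-∀
  ∣a-q∣·∣b∣<1·∣b∣ : ℤ.∣ a - q ∣ ℕ.* ℤ.∣ b ∣ < 1 ℕ.* ℤ.∣ b ∣
  ∣a-q∣·∣b∣<1·∣b∣ =
    subst₂ _<_ (trans (cong ℤ.∣_∣ (sym remainder)) (ℤP.abs-* (a - q) b))
               (sym (ℕP.*-identityˡ ℤ.∣ b ∣)) (ℤD.n%d<d (a * b) b)
  ∣a-q∣≡0 : ℤ.∣ a - q ∣ ≡ 0
  ∣a-q∣≡0 = ℕP.n<1⇒n≡0 (ℕP.*-cancelʳ-< ℤ.∣ b ∣ _ 1 ∣a-q∣·∣b∣<1·∣b∣)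

divℤ-exact : ∀ a {b} → b ≢ 0ℤ → divℤ (a * b) b ≡ a
divℤ-exact a {+ zero}      b≢0 = ⊥-elim (b≢0 refl)
divℤ-exact a {+ suc n}     _   = /-exact a (+ suc n)
divℤ-exact a {ℤ.-[1+ n ]} _   = /-exact a ℤ.-[1+ n ]

square-scale : ∀ {c x} → c ≢ 0ℤ → IsSquare x → IsSquare (c * c * x)
square-scale {c} c≢0 (β , β≢0 , x≡±β²) = c * β , *-≢0 c≢0 β≢0 , scaled x≡±β²
  where
  pos : ∀ c β → c * c * (β * β) ≡ c * β * (c * β)
  pos = ℤSolver.solve-∀
  neg : ∀ c β → c * c * - (β * β) ≡ - (c * β * (c * β))
  neg = ℤSolver.solve-∀
  scaled : ∀ {x} → x ≡ β * β ⊎ x ≡ - (β * β) →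
           c * c * x ≡ c * β * (c * β) ⊎ c * c * x ≡ - (c * β * (c * β))
  scaled (inj₁ refl) = inj₁ (pos c β)
  scaled (inj₂ refl) = inj₂ (neg c β)

cube-scale : ∀ {c x} → c ≢ 0ℤ → IsCube x → IsCube (c * c * c * x)
cube-scale {c} c≢0 (β , β≢0 , refl) = c * β , *-≢0 c≢0 β≢0 , regroup c β
  where
  regroup : ∀ c β → c * c * c * (β * β * β) ≡ c * β * (c * β) * (c * β)
  regroup = ℤSolver.solve-∀

oddForm : ℤ → ℤ → ℤ → ℤ → ℤ
oddForm a b c d = a * (b * b * b) - c * (d * d * d)

evenForm : ℤ → ℤ → ℤ → ℤ → ℤ → ℤ
evenForm a b c d e = a * (b * (c * c) - d * (e * e))

oddRHS : (ℕ → ℤ) → ℕ → ℤ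
oddRHS f m = oddForm (f (m + 2)) (f m) (f (m ∸ 1)) (f (m + 1))

evenRHS : (ℕ → ℤ) → ℕ → ℤ
evenRHS f m = evenForm (f m) (f (m + 2)) (f (m ∸ 1)) (f (m ∸ 2)) (f (m + 1))

oddForm-cong : ∀ {a a′ b b′ c c′ d d′} → a ≡ a′ → b ≡ b′ → c ≡ c′ → d ≡ d′ →
               oddForm a b c d ≡ oddForm a′ b′ c′ d′
oddForm-cong refl refl refl refl = refl

evenForm-cong : ∀ {a a′ b b′ c c′ d d′ e e′} → a ≡ a′ → b ≡ b′ → c ≡ c′ → d ≡ d′ → e ≡ e′ →
                evenForm a b c d e ≡ evenForm a′ b′ c′ d′ e′
evenForm-cong refl refl refl refl refl = refl

oddRHS-cong : ∀ {f f′} m → (∀ {i} → i ≤ m + 2 → f i ≡ f′ i) → oddRHS f m ≡ oddRHS f′ m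
oddRHS-cong m agree =
  oddForm-cong (agree ℕP.≤-refl) (agree (ℕP.m≤m+n m 2))
               (agree (ℕP.≤-trans (ℕP.m∸n≤m m 1) (ℕP.m≤m+n m 2)))
               (agree (ℕP.+-monoʳ-≤ m (s≤s z≤n)))

evenRHS-cong : ∀ {f f′} m → (∀ {i} → i ≤ m + 2 → f i ≡ f′ i) → evenRHS f m ≡ evenRHS f′ m
evenRHS-cong m agree =
  evenForm-cong (agree (ℕP.m≤m+n m 2)) (agree ℕP.≤-refl)
                (agree (ℕP.≤-trans (ℕP.m∸n≤m m 1) (ℕP.m≤m+n m 2)))
                (agree (ℕP.≤-trans (ℕP.m∸n≤m m 2) (ℕP.m≤m+n m 2)))
                (agree (ℕP.+-monoʳ-≤ m (s≤s z≤n)))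

next-odd : ∀ α l j → (5 + j) % 2 ≡ 1 → next α l (5 + j) ≡ oddRHS (get l) ((5 + j) / 2)
next-odd α l j odd rewrite odd = refl

next-even : ∀ α l j → (5 + j) % 2 ≡ 0 →
            next α l (5 + j) ≡ divℤ (evenRHS (get l) ((5 + j) / 2)) (get l 2)
next-even α l j even rewrite even = refl

odd-rescale : ∀ {w} p₀ p₁ p₂ p₃ a b c d →
              p₃ * (p₁ * p₁ * p₁) ≡ w → p₀ * (p₂ * p₂ * p₂) ≡ w →
              oddForm (- p₃ * a) (- p₁ * b) (- p₀ * c) (- p₂ * d) ≡ w * oddForm a b c d
odd-rescale p₀ p₁ p₂ p₃ a b c d refl same = begin
  oddForm (- p₃ * a) (- p₁ * b) (- p₀ * c) (- p₂ * d)
    ≡⟨ expand p₀ p₁ p₂ p₃ a b c d ⟩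
  w₁ * (a * (b * b * b)) - p₀ * (p₂ * p₂ * p₂) * (c * (d * d * d))
    ≡⟨ cong (λ v → w₁ * (a * (b * b * b)) - v * (c * (d * d * d))) same ⟩
  w₁ * (a * (b * b * b)) - w₁ * (c * (d * d * d))
    ≡⟨ factor w₁ (a * (b * b * b)) (c * (d * d * d)) ⟩
  w₁ * oddForm a b c d ∎
  where
  w₁ = p₃ * (p₁ * p₁ * p₁)
  expand : ∀ p₀ p₁ p₂ p₃ a b c d →
    (- p₃ * a) * ((- p₁ * b) * (- p₁ * b) * (- p₁ * b))
      - (- p₀ * c) * ((- p₂ * d) * (- p₂ * d) * (- p₂ * d))
    ≡ p₃ * (p₁ * p₁ * p₁) * (a * (b * b * b)) - p₀ * (p₂ * p₂ * p₂) * (c * (d * d * d))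
  expand = ℤSolver.solve-∀
  factor : ∀ u x y → u * x - u * y ≡ u * (x - y)
  factor = ℤSolver.solve-∀

even-rescale : ∀ {w} pa pb pc pd pe a b c d e →
               pa * (pb * (pc * pc)) ≡ w → pa * (pd * (pe * pe)) ≡ w →
               evenForm (- pa * a) (- pb * b) (- pc * c) (- pd * d) (- pe * e)
                 ≡ w * evenForm a b c d e
even-rescale pa pb pc pd pe a b c d e refl same = begin
  evenForm (- pa * a) (- pb * b) (- pc * c) (- pd * d) (- pe * e)
    ≡⟨ expand pa pb pc pd pe a b c d e ⟩
  w₁ * (a * (b * (c * c))) - pa * (pd * (pe * pe)) * (a * (d * (e * e)))
    ≡⟨ cong (λ v → w₁ * (a * (b * (c * c))) - v * (a * (d * (e * e)))) same ⟩
  w₁ * (a * (b * (c * c))) - w₁ * (a * (d * (e * e)))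
    ≡⟨ factor w₁ a (b * (c * c)) (d * (e * e)) ⟩
  w₁ * evenForm a b c d e ∎
  where
  w₁ = pa * (pb * (pc * pc))
  expand : ∀ pa pb pc pd pe a b c d e →
    (- pa * a) * ((- pb * b) * ((- pc * c) * (- pc * c)) - (- pd * d) * ((- pe * e) * (- pe * e)))
    ≡ pa * (pb * (pc * pc)) * (a * (b * (c * c))) - pa * (pd * (pe * pe)) * (a * (d * (e * e)))
  expand = ℤSolver.solve-∀
  factor : ∀ u a x y → u * (a * x) - u * (a * y) ≡ u * (a * (x - y))
  factor = ℤSolver.solve-∀

twice-rescale : ∀ {w} p q x → p * q ≡ w → - p * (- q * x) ≡ w * x
twice-rescale p q x refl = regroup p q x
  where
  regroup : ∀ p q x → - p * (- q * x) ≡ p * q * x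
  regroup = ℤSolver.solve-∀

thrice-rescale : ∀ p q r u x → p * (q * r) ≡ u * u * u →
                 - p * (- q * (- r * x)) ≡ (- u) * (- u) * (- u) * x
thrice-rescale p q r u x pqr≡u³ = begin
  - p * (- q * (- r * x)) ≡⟨ regroup p q r x ⟩
  - (p * (q * r)) * x     ≡⟨ cong (λ v → - v * x) pqr≡u³ ⟩
  - (u * u * u) * x       ≡⟨ negate-cube u x ⟩
  (- u) * (- u) * (- u) * x ∎
  where
  regroup : ∀ p q r x → - p * (- q * (- r * x)) ≡ - (p * (q * r)) * x
  regroup = ℤSolver.solve-∀
  negate-cube : ∀ u x → - (u * u * u) * x ≡ (- u) * (- u) * (- u) * x
  negate-cube = ℤSolver.solve-∀

module ClosedForm (α : ℤ) where

  pow-+ : ∀ x y → α ^ (x + y) ≡ α ^ x * α ^ y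
  pow-+ = ℤP.^-distribˡ-+-* α

  pow-+³ : ∀ x y z → α ^ x * (α ^ y * α ^ z) ≡ α ^ (x + (y + z))
  pow-+³ x y z = trans (cong (α ^ x *_) (sym (pow-+ y z))) (sym (pow-+ x (y + z)))

  pow-cube : ∀ u → α ^ u * α ^ u * α ^ u ≡ α ^ (u + u + u)
  pow-cube u = trans (cong (_* α ^ u) (sym (pow-+ u u))) (sym (pow-+ (u + u) u))

  pow-odd : ∀ x y → α ^ x * (α ^ y * α ^ y * α ^ y) ≡ α ^ (x + (y + y + y))
  pow-odd x y = trans (cong (α ^ x *_) (pow-cube y)) (sym (pow-+ x (y + y + y)))

  pow-even : ∀ x y z → α ^ x * (α ^ y * (α ^ z * α ^ z)) ≡ α ^ (x + (y + (z + z)))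
  pow-even x y z =
    trans (cong (λ v → α ^ x * (α ^ y * v)) (sym (pow-+ z z))) (pow-+³ x y (z + z))

  -- ρ n = α^(4n+10) is the factor gained (up to sign) over one period of length 5.
  ρ : ℕ → ℤ
  ρ n = α ^ (4 ℕ.* n + 10)

  g : ℕ → ℤ
  g 0 = 0ℤ
  g 1 = 1ℤ
  g 2 = - α
  g 3 = - (α * α * α)
  g 4 = α * α * α * α * α * α
  g (suc (suc (suc (suc (suc n))))) = - ρ n * g n

  -- Signed monomials s · αᵉ; every single value g n is of this shape.
  mono : ℤ → ℕ → ℤ
  mono s e = s * α ^ e

  mono-* : ∀ s e t f → mono s e * mono t f ≡ mono (s * t) (e + f)
  mono-* s e t f = trans (regroup s (α ^ e) t (α ^ f)) (cong ((s * t) *_) (sym (pow-+ e f)))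
    where
    regroup : ∀ s x t y → s * x * (t * y) ≡ s * t * (x * y)
    regroup = ℤSolver.solve-∀

  oddForm-mono : ∀ s₁ e₁ s₂ e₂ s₃ e₃ s₄ e₄ →
    oddForm (mono s₁ e₁) (mono s₂ e₂) (mono s₃ e₃) (mono s₄ e₄)
      ≡ mono (s₁ * (s₂ * s₂ * s₂)) (e₁ + (e₂ + e₂ + e₂))
        - mono (s₃ * (s₄ * s₄ * s₄)) (e₃ + (e₄ + e₄ + e₄))
  oddForm-mono s₁ e₁ s₂ e₂ s₃ e₃ s₄ e₄ =
    cong₂ _-_ (times-cube s₁ e₁ s₂ e₂) (times-cube s₃ e₃ s₄ e₄)
    where
    times-cube : ∀ s e t f → mono s e * (mono t f * mono t f * mono t f)
                               ≡ mono (s * (t * t * t)) (e + (f + f + f))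
    times-cube s e t f = begin
      mono s e * (mono t f * mono t f * mono t f)
        ≡⟨ cong (λ x → mono s e * (x * mono t f)) (mono-* t f t f) ⟩
      mono s e * (mono (t * t) (f + f) * mono t f)
        ≡⟨ cong (mono s e *_) (mono-* (t * t) (f + f) t f) ⟩
      mono s e * mono (t * t * t) (f + f + f)
        ≡⟨ mono-* s e (t * t * t) (f + f + f) ⟩
      mono (s * (t * t * t)) (e + (f + f + f)) ∎

  evenForm-mono : ∀ s₁ e₁ s₂ e₂ s₃ e₃ s₄ e₄ s₅ e₅ →
    evenForm (mono s₁ e₁) (mono s₂ e₂) (mono s₃ e₃) (mono s₄ e₄) (mono s₅ e₅)
      ≡ mono (s₁ * (s₂ * (s₃ * s₃))) (e₁ + (e₂ + (e₃ + e₃)))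
        - mono (s₁ * (s₄ * (s₅ * s₅))) (e₁ + (e₄ + (e₅ + e₅)))
  evenForm-mono s₁ e₁ s₂ e₂ s₃ e₃ s₄ e₄ s₅ e₅ =
    trans (distrib (mono s₁ e₁) _ _)
          (cong₂ _-_ (times-square s₁ e₁ s₂ e₂ s₃ e₃) (times-square s₁ e₁ s₄ e₄ s₅ e₅))
    where
    distrib : ∀ x y z → x * (y - z) ≡ x * y - x * z
    distrib = ℤSolver.solve-∀
    times-square : ∀ s e t f u h → mono s e * (mono t f * (mono u h * mono u h))
                                     ≡ mono (s * (t * (u * u))) (e + (f + (h + h)))
    times-square s e t f u h = begin
      mono s e * (mono t f * (mono u h * mono u h))
        ≡⟨ cong (λ x → mono s e * (mono t f * x)) (mono-* u h u h) ⟩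
      mono s e * (mono t f * mono (u * u) (h + h))
        ≡⟨ cong (mono s e *_) (mono-* t f (u * u) (h + h)) ⟩
      mono s e * mono (t * (u * u)) (f + (h + h))
        ≡⟨ mono-* s e (t * (u * u)) (f + (h + h)) ⟩
      mono (s * (t * (u * u))) (e + (f + (h + h))) ∎

  mono-diff : ∀ s t e → mono s e - mono t e ≡ mono (s - t) e
  mono-diff s t e = factor s t (α ^ e)
    where
    factor : ∀ s t x → s * x - t * x ≡ (s - t) * x
    factor = ℤSolver.solve-∀

  mono-diff-0ˡ : ∀ t f → 0ℤ - mono t f ≡ mono (- t) f
  mono-diff-0ˡ t f = negate t (α ^ f)
    where
    negate : ∀ t x → 0ℤ - t * x ≡ (- t) * x
    negate = ℤSolver.solve-∀

  mono-diff-0ʳ : ∀ s e → mono s e - 0ℤ ≡ mono s e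
  mono-diff-0ʳ s e = ℤP.+-identityʳ (mono s e)

  record Value (n : ℕ) (s : ℤ) (e : ℕ) : Set where
    constructor value
    field value-eq : g n ≡ mono s e
  open Value

  period-mono : ∀ {n s e} → Value n s e → Value (5 + n) (- s) (4 ℕ.* n + 10 + e)
  period-mono {n} {s} {e} (value gn≡) = value (begin
    - ρ n * g n           ≡⟨ cong (- ρ n *_) gn≡ ⟩
    - ρ n * (s * α ^ e)   ≡⟨ swap (ρ n) s (α ^ e) ⟩
    - s * (ρ n * α ^ e)   ≡⟨ cong (- s *_) (sym (pow-+ (4 ℕ.* n + 10) e)) ⟩
    mono (- s) (4 ℕ.* n + 10 + e) ∎)
    where
    swap : ∀ p s x → - p * (s * x) ≡ - s * (p * x)
    swap = ℤSolver.solve-∀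

  g₀ : Value 0 0ℤ 0
  g₀ = value refl

  g₁ : Value 1 1ℤ 0
  g₁ = value refl

  g₂ : Value 2 -1ℤ 1
  g₂ = value (expand α)
    where
    expand : ∀ a → - a ≡ -1ℤ * (a * 1ℤ)
    expand = ℤSolver.solve-∀

  g₃ : Value 3 -1ℤ 3
  g₃ = value (expand α)
    where
    expand : ∀ a → - (a * a * a) ≡ -1ℤ * (a * (a * (a * 1ℤ)))
    expand = ℤSolver.solve-∀

  g₄ : Value 4 1ℤ 6
  g₄ = value (expand α)
    where
    expand : ∀ a → a * a * a * a * a * a ≡ 1ℤ * (a * (a * (a * (a * (a * (a * 1ℤ))))))
    expand = ℤSolver.solve-∀

  g₅ : Value 5 0ℤ 10
  g₅ = period-mono g₀

  g₆ : Value 6 -1ℤ 14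
  g₆ = period-mono g₁

  g₇ : Value 7 1ℤ 19
  g₇ = period-mono g₂

  g₈ : Value 8 1ℤ 25
  g₈ = period-mono g₃

  g₉ : Value 9 -1ℤ 32
  g₉ = period-mono g₄

  g₁₀ : Value 10 0ℤ 40
  g₁₀ = period-mono g₅

  g₁₁ : Value 11 1ℤ 48
  g₁₁ = period-mono g₆

  g₁₂ : Value 12 -1ℤ 57
  g₁₂ = period-mono g₇

  g₁₄ : Value 14 1ℤ 78
  g₁₄ = period-mono g₉

  -- The duplication formulas at m = 1 + k (odd) and m = 2 + k (even), written with the
  -- constant part of every index in front so that a shift k ↦ 5 + k unfolds g.
  OddDupAt : ℕ → Set
  OddDupAt k = oddForm (g (3 + k)) (g (1 + k)) (g k) (g (2 + k)) ≡ g (3 + (k + k))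

  EvenDupAt : ℕ → Set
  EvenDupAt k = evenForm (g (2 + k)) (g (4 + k)) (g (1 + k)) (g k) (g (3 + k))
                  ≡ g (4 + (k + k)) * g 2

  odd-from-table : ∀ {a b c d r s₁ e₁ s₂ e₂ s₃ e₃ s₄ e₄ s e} →
    Value a s₁ e₁ → Value b s₂ e₂ → Value c s₃ e₃ → Value d s₄ e₄ → Value r s e →
    mono (s₁ * (s₂ * s₂ * s₂)) (e₁ + (e₂ + e₂ + e₂))
      - mono (s₃ * (s₄ * s₄ * s₄)) (e₃ + (e₄ + e₄ + e₄)) ≡ mono s e →
    oddForm (g a) (g b) (g c) (g d) ≡ g r
  odd-from-table {s₁ = s₁} {e₁} {s₂} {e₂} {s₃} {e₃} {s₄} {e₄}
                 (value ga) (value gb) (value gc) (value gd) (value gr) closing =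
    trans (oddForm-cong ga gb gc gd)
      (trans (oddForm-mono s₁ e₁ s₂ e₂ s₃ e₃ s₄ e₄) (trans closing (sym gr)))

  even-from-table : ∀ {a b c d e r s₁ e₁ s₂ e₂ s₃ e₃ s₄ e₄ s₅ e₅ s e′} →
    Value a s₁ e₁ → Value b s₂ e₂ → Value c s₃ e₃ → Value d s₄ e₄ → Value e s₅ e₅ →
    Value r s e′ →
    mono (s₁ * (s₂ * (s₃ * s₃))) (e₁ + (e₂ + (e₃ + e₃)))
      - mono (s₁ * (s₄ * (s₅ * s₅))) (e₁ + (e₄ + (e₅ + e₅))) ≡ mono (s * -1ℤ) (e′ + 1) →
    evenForm (g a) (g b) (g c) (g d) (g e) ≡ g r * g 2
  even-from-table {s₁ = s₁} {e₁} {s₂} {e₂} {s₃} {e₃} {s₄} {e₄} {s₅} {e₅} {s} {e′}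
                  (value ga) (value gb) (value gc) (value gd) (value ge) (value gr) closing =
    trans (evenForm-cong ga gb gc gd ge)
      (trans (evenForm-mono s₁ e₁ s₂ e₂ s₃ e₃ s₄ e₄ s₅ e₅)
        (trans closing (sym (trans (cong₂ _*_ gr (value-eq g₂)) (mono-* s e′ -1ℤ 1)))))

  odd-dup-step : ∀ k → OddDupAt k → OddDupAt (5 + k)
  odd-dup-step k ih = begin
    oddForm (g (8 + k)) (g (6 + k)) (g (5 + k)) (g (7 + k))
      ≡⟨ odd-rescale (ρ k) (ρ (1 + k)) (ρ (2 + k)) (ρ (3 + k)) _ _ _ _ w₁ w₂ ⟩
    α ^ W * oddForm (g (3 + k)) (g (1 + k)) (g k) (g (2 + k))
      ≡⟨ cong (α ^ W *_) ih ⟩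
    α ^ W * g (3 + (k + k))
      ≡⟨ sym (twice-rescale (ρ (8 + (k + k))) (ρ (3 + (k + k))) _ w₃) ⟩
    g (13 + (k + k))
      ≡⟨ cong g (index k) ⟩
    g (3 + ((5 + k) + (5 + k))) ∎
    where
    W = 16 ℕ.* k + 64
    w₁ : ρ (3 + k) * (ρ (1 + k) * ρ (1 + k) * ρ (1 + k)) ≡ α ^ W
    w₁ = trans (pow-odd (4 ℕ.* (3 + k) + 10) (4 ℕ.* (1 + k) + 10)) (cong (α ^_) (exp₁ k))
      where
      exp₁ : ∀ k → 4 ℕ.* (3 + k) + 10 + (4 ℕ.* (1 + k) + 10 + (4 ℕ.* (1 + k) + 10)
                                          + (4 ℕ.* (1 + k) + 10)) ≡ 16 ℕ.* k + 64
      exp₁ = ℕSolver.solve-∀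
    w₂ : ρ k * (ρ (2 + k) * ρ (2 + k) * ρ (2 + k)) ≡ α ^ W
    w₂ = trans (pow-odd (4 ℕ.* k + 10) (4 ℕ.* (2 + k) + 10)) (cong (α ^_) (exp₂ k))
      where
      exp₂ : ∀ k → 4 ℕ.* k + 10 + (4 ℕ.* (2 + k) + 10 + (4 ℕ.* (2 + k) + 10)
                                      + (4 ℕ.* (2 + k) + 10)) ≡ 16 ℕ.* k + 64
      exp₂ = ℕSolver.solve-∀
    w₃ : ρ (8 + (k + k)) * ρ (3 + (k + k)) ≡ α ^ W
    w₃ = trans (sym (pow-+ (4 ℕ.* (8 + (k + k)) + 10) (4 ℕ.* (3 + (k + k)) + 10)))
               (cong (α ^_) (exp₃ k))
      where
      exp₃ : ∀ k → 4 ℕ.* (8 + (k + k)) + 10 + (4 ℕ.* (3 + (k + k)) + 10) ≡ 16 ℕ.* k + 64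
      exp₃ = ℕSolver.solve-∀
    index : ∀ k → 13 + (k + k) ≡ 3 + ((5 + k) + (5 + k))
    index = ℕSolver.solve-∀

  even-dup-step : ∀ k → EvenDupAt k → EvenDupAt (5 + k)
  even-dup-step k ih = begin
    evenForm (g (7 + k)) (g (9 + k)) (g (6 + k)) (g (5 + k)) (g (8 + k))
      ≡⟨ even-rescale (ρ (2 + k)) (ρ (4 + k)) (ρ (1 + k)) (ρ k) (ρ (3 + k)) _ _ _ _ _ w₁ w₂ ⟩
    α ^ W * evenForm (g (2 + k)) (g (4 + k)) (g (1 + k)) (g k) (g (3 + k))
      ≡⟨ cong (α ^ W *_) ih ⟩
    α ^ W * (g (4 + (k + k)) * g 2)
      ≡⟨ sym (ℤP.*-assoc (α ^ W) (g (4 + (k + k))) (g 2)) ⟩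
    α ^ W * g (4 + (k + k)) * g 2
      ≡⟨ cong (_* g 2) (sym (twice-rescale (ρ (9 + (k + k))) (ρ (4 + (k + k))) _ w₃)) ⟩
    g (14 + (k + k)) * g 2
      ≡⟨ cong (λ i → g i * g 2) (index k) ⟩
    g (4 + ((5 + k) + (5 + k))) * g 2 ∎
    where
    W = 16 ℕ.* k + 72
    w₁ : ρ (2 + k) * (ρ (4 + k) * (ρ (1 + k) * ρ (1 + k))) ≡ α ^ W
    w₁ = trans (pow-even (4 ℕ.* (2 + k) + 10) (4 ℕ.* (4 + k) + 10) (4 ℕ.* (1 + k) + 10))
               (cong (α ^_) (exp₁ k))
      where
      exp₁ : ∀ k → 4 ℕ.* (2 + k) + 10 + (4 ℕ.* (4 + k) + 10
                     + (4 ℕ.* (1 + k) + 10 + (4 ℕ.* (1 + k) + 10))) ≡ 16 ℕ.* k + 72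
      exp₁ = ℕSolver.solve-∀
    w₂ : ρ (2 + k) * (ρ k * (ρ (3 + k) * ρ (3 + k))) ≡ α ^ W
    w₂ = trans (pow-even (4 ℕ.* (2 + k) + 10) (4 ℕ.* k + 10) (4 ℕ.* (3 + k) + 10))
               (cong (α ^_) (exp₂ k))
      where
      exp₂ : ∀ k → 4 ℕ.* (2 + k) + 10 + (4 ℕ.* k + 10
                     + (4 ℕ.* (3 + k) + 10 + (4 ℕ.* (3 + k) + 10))) ≡ 16 ℕ.* k + 72
      exp₂ = ℕSolver.solve-∀
    w₃ : ρ (9 + (k + k)) * ρ (4 + (k + k)) ≡ α ^ W
    w₃ = trans (sym (pow-+ (4 ℕ.* (9 + (k + k)) + 10) (4 ℕ.* (4 + (k + k)) + 10)))
               (cong (α ^_) (exp₃ k))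
      where
      exp₃ : ∀ k → 4 ℕ.* (9 + (k + k)) + 10 + (4 ℕ.* (4 + (k + k)) + 10) ≡ 16 ℕ.* k + 72
      exp₃ = ℕSolver.solve-∀
    index : ∀ k → 14 + (k + k) ≡ 4 + ((5 + k) + (5 + k))
    index = ℕSolver.solve-∀

  -- In
  -- each base case the two monomials have equal exponents or one of them vanishes (it contains
  -- a value g (5q)).
  odd-dup : ∀ k → OddDupAt k
  odd-dup = induction-mod-5 OddDupAt
    (odd-from-table g₃ g₁ g₀ g₂ g₃ (mono-diff-0ʳ -1ℤ 3))
    (odd-from-table g₄ g₂ g₁ g₃ g₅ (mono-diff -1ℤ -1ℤ 9))
    (odd-from-table g₅ g₃ g₂ g₄ g₇ (mono-diff 0ℤ -1ℤ 19))
    (odd-from-table g₆ g₄ g₃ g₅ g₉ (mono-diff-0ʳ -1ℤ 32))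
    (odd-from-table g₇ g₅ g₄ g₆ g₁₁ (mono-diff-0ˡ -1ℤ 48))
    odd-dup-step

  even-dup : ∀ k → EvenDupAt k
  even-dup = induction-mod-5 EvenDupAt
    (even-from-table g₂ g₄ g₁ g₀ g₃ g₄ (mono-diff-0ʳ -1ℤ 7))
    (even-from-table g₃ g₅ g₂ g₁ g₄ g₆ (mono-diff-0ˡ -1ℤ 15))
    (even-from-table g₄ g₆ g₃ g₂ g₅ g₈ (mono-diff-0ʳ -1ℤ 26))
    (even-from-table g₅ g₇ g₄ g₃ g₆ g₁₀ refl)
    (even-from-table g₆ g₈ g₅ g₄ g₇ g₁₂ (mono-diff-0ˡ -1ℤ 58))
    even-dup-step

  odd-duplication : ∀ m → 1 ≤ m → oddRHS g m ≡ g (suc (m + m))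
  odd-duplication (suc k) _ =
    trans (cong₂ (λ i j → oddForm (g i) (g (suc k)) (g k) (g j)) (index₁ k) (index₂ k))
          (trans (odd-dup k) (cong g (index₃ k)))
    where
    index₁ : ∀ k → suc k + 2 ≡ 3 + k
    index₁ = ℕSolver.solve-∀
    index₂ : ∀ k → suc k + 1 ≡ 2 + k
    index₂ = ℕSolver.solve-∀
    index₃ : ∀ k → 3 + (k + k) ≡ suc (suc k + suc k)
    index₃ = ℕSolver.solve-∀

  even-duplication : ∀ m → 2 ≤ m → evenRHS g m ≡ g (m + m) * g 2
  even-duplication (suc zero) (s≤s ())
  even-duplication (suc (suc k)) _ =
    trans (cong₂ (λ i j → evenForm (g (2 + k)) (g i) (g (1 + k)) (g k) (g j))
                 (index₁ k) (index₂ k))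
          (trans (even-dup k) (cong (λ i → g i * g 2) (index₃ k)))
    where
    index₁ : ∀ k → 2 + k + 2 ≡ 4 + k
    index₁ = ℕSolver.solve-∀
    index₂ : ∀ k → 2 + k + 1 ≡ 3 + k
    index₂ = ℕSolver.solve-∀
    index₃ : ∀ k → 4 + (k + k) ≡ 2 + k + (2 + k)
    index₃ = ℕSolver.solve-∀

  gs : ℕ → List ℤ
  gs zero    = []
  gs (suc n) = gs n ++ [ g n ]

  length-gs : ∀ n → length (gs n) ≡ n
  length-gs zero    = refl
  length-gs (suc n) =
    trans (length-++ (gs n)) (trans (ℕP.+-comm (length (gs n)) 1) (cong suc (length-gs n)))

  get-gs : ∀ {n i} → i < n → get (gs n) i ≡ g i
  get-gs {suc n} {i} (s≤s i≤n) with ℕP.m≤n⇒m<n∨m≡n i≤n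
  ... | inj₁ i<n  =
    trans (get-++ˡ (gs n) (subst (i <_) (sym (length-gs n)) i<n)) (get-gs i<n)
  ... | inj₂ refl =
    subst (λ j → get (gs i ++ [ g i ]) j ≡ g i) (length-gs i) (get-++-length (gs i) [ g i ])

  next-g : α ≢ 0ℤ → ∀ n → next α (gs n) n ≡ g n
  next-g _ 0 = refl
  next-g _ 1 = refl
  next-g _ 2 = refl
  next-g _ 3 = refl
  next-g _ 4 = refl
  next-g α≢0 (suc (suc (suc (suc (suc j))))) with halving (5 + j)
  ... | inj₂ (odd , n≡2m+1) = begin
    next α (gs (5 + j)) (5 + j)  ≡⟨ next-odd α (gs (5 + j)) j odd ⟩
    oddRHS (get (gs (5 + j))) m  ≡⟨ oddRHS-cong m (λ i≤ → get-gs (ℕP.≤-<-trans i≤ window)) ⟩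
    oddRHS g m                   ≡⟨ odd-duplication m (ℕP.≤-trans (s≤s z≤n) 2≤m) ⟩
    g (suc (m + m))              ≡⟨ cong g (sym n≡2m+1) ⟩
    g (5 + j)                    ∎
    where
    m = (5 + j) / 2
    2≤m = odd-half-≥2 m n≡2m+1
    window : m + 2 < 5 + j
    window = subst (m + 2 <_) (sym n≡2m+1) (s≤s (ℕP.+-monoʳ-≤ m 2≤m))
  ... | inj₁ (even , n≡2m) = begin
    next α (gs (5 + j)) (5 + j)
      ≡⟨ next-even α (gs (5 + j)) j even ⟩
    divℤ (evenRHS (get (gs (5 + j))) m) (get (gs (5 + j)) 2)
      ≡⟨ cong₂ divℤ (evenRHS-cong m lookup) (lookup (ℕP.m≤n+m 2 m)) ⟩
    divℤ (evenRHS g m) (g 2)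
      ≡⟨ cong (λ x → divℤ x (g 2)) (even-duplication m (ℕP.≤-trans (s≤s (s≤s z≤n)) 3≤m)) ⟩
    divℤ (g (m + m) * g 2) (g 2)
      ≡⟨ divℤ-exact (g (m + m)) (-≢0 α≢0) ⟩
    g (m + m)
      ≡⟨ cong g (sym n≡2m) ⟩
    g (5 + j) ∎
    where
    m = (5 + j) / 2
    3≤m = even-half-≥3 m n≡2m
    window : m + 2 < 5 + j
    window = subst (m + 2 <_) (sym n≡2m) (ℕP.+-monoʳ-< m 3≤m)
    lookup : ∀ {i} → i ≤ m + 2 → get (gs (5 + j)) i ≡ g i
    lookup i≤ = get-gs (ℕP.≤-<-trans i≤ window)

  hs≡gs : α ≢ 0ℤ → ∀ n → hs α n ≡ gs n
  hs≡gs α≢0 zero    = refl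
  hs≡gs α≢0 (suc n) = begin
    hs α n ++ [ next α (hs α n) n ] ≡⟨ cong (λ l → l ++ [ next α l n ]) (hs≡gs α≢0 n) ⟩
    gs n ++ [ next α (gs n) n ]     ≡⟨ cong (λ x → gs n ++ [ x ]) (next-g α≢0 n) ⟩
    gs n ++ [ g n ]                 ∎

  h≡g : α ≢ 0ℤ → ∀ n → h α n ≡ g n
  h≡g α≢0 n = trans (cong (λ l → get l n) (hs≡gs α≢0 (suc n))) (get-gs (ℕP.n<1+n n))

  w u : ℕ → ℤ
  w n = α ^ (4 ℕ.* n + 20)
  u n = α ^ (4 ℕ.* n + 30)

  square-period : ∀ n → g (10 + n) ≡ w n * w n * g n
  square-period n = twice-rescale (ρ (5 + n)) (ρ n) (g n) weight
    where
    exps : ∀ n → 4 ℕ.* (5 + n) + 10 + (4 ℕ.* n + 10) ≡ 4 ℕ.* n + 20 + (4 ℕ.* n + 20)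
    exps = ℕSolver.solve-∀
    weight : ρ (5 + n) * ρ n ≡ w n * w n
    weight = trans (sym (pow-+ (4 ℕ.* (5 + n) + 10) (4 ℕ.* n + 10)))
                   (trans (cong (α ^_) (exps n)) (pow-+ (4 ℕ.* n + 20) (4 ℕ.* n + 20)))

  cube-period : ∀ n → g (15 + n) ≡ (- u n) * (- u n) * (- u n) * g n
  cube-period n = thrice-rescale (ρ (10 + n)) (ρ (5 + n)) (ρ n) (u n) (g n) weight
    where
    exps : ∀ n → 4 ℕ.* (10 + n) + 10 + (4 ℕ.* (5 + n) + 10 + (4 ℕ.* n + 10))
                   ≡ 4 ℕ.* n + 30 + (4 ℕ.* n + 30) + (4 ℕ.* n + 30)
    exps = ℕSolver.solve-∀
    weight : ρ (10 + n) * (ρ (5 + n) * ρ n) ≡ u n * u n * u n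
    weight = trans (pow-+³ (4 ℕ.* (10 + n) + 10) (4 ℕ.* (5 + n) + 10) (4 ℕ.* n + 10))
                   (trans (cong (α ^_) (exps n)) (sym (pow-cube (4 ℕ.* n + 30))))

  square-value : α ≢ 0ℤ → ∀ {r s} k → s ≡ 1ℤ ⊎ s ≡ -1ℤ → Value r s (k + k) → IsSquare (g r)
  square-value α≢0 k sign (value gr) =
    subst IsSquare (sym gr) (α ^ k , ^-≢0 α≢0 k , signed sign)
    where
    signed : ∀ {s} → s ≡ 1ℤ ⊎ s ≡ -1ℤ →
             mono s (k + k) ≡ α ^ k * α ^ k ⊎ mono s (k + k) ≡ - (α ^ k * α ^ k)
    signed (inj₁ refl) = inj₁ (trans (ℤP.*-identityˡ _) (pow-+ k k))
    signed (inj₂ refl) = inj₂ (trans (ℤP.-1*i≡-i _) (cong -_ (pow-+ k k)))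

  cube-value : α ≢ 0ℤ → ∀ {r s} k → s ≡ 1ℤ ⊎ s ≡ -1ℤ → Value r s (k + k + k) → IsCube (g r)
  cube-value α≢0 k sign (value gr) = subst IsCube (sym gr) (cubed sign)
    where
    cubed : ∀ {s} → s ≡ 1ℤ ⊎ s ≡ -1ℤ → IsCube (mono s (k + k + k))
    cubed (inj₁ refl) = mono 1ℤ k , *-≢0 {x = 1ℤ} (λ ()) (^-≢0 α≢0 k) ,
                        trans (cong (1ℤ *_) (sym (pow-cube k))) (spread₊ (α ^ k))
      where
      spread₊ : ∀ x → 1ℤ * (x * x * x) ≡ 1ℤ * x * (1ℤ * x) * (1ℤ * x)
      spread₊ = ℤSolver.solve-∀
    cubed (inj₂ refl) = mono -1ℤ k , *-≢0 {x = -1ℤ} (λ ()) (^-≢0 α≢0 k) ,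
                        trans (cong (-1ℤ *_) (sym (pow-cube k))) (spread₋ (α ^ k))
      where
      spread₋ : ∀ x → -1ℤ * (x * x * x) ≡ -1ℤ * x * (-1ℤ * x) * (-1ℤ * x)
      spread₋ = ℤSolver.solve-∀

  square-base : α ≢ 0ℤ → ∀ {r} → r ≡ 1 ⊎ r ≡ 4 ⊎ r ≡ 6 ⊎ r ≡ 9 → IsSquare (g r)
  square-base α≢0 (inj₁ refl)               = square-value α≢0 0 (inj₁ refl) g₁
  square-base α≢0 (inj₂ (inj₁ refl))        = square-value α≢0 3 (inj₁ refl) g₄
  square-base α≢0 (inj₂ (inj₂ (inj₁ refl))) = square-value α≢0 7 (inj₂ refl) g₆
  square-base α≢0 (inj₂ (inj₂ (inj₂ refl))) = square-value α≢0 16 (inj₂ refl) g₉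

  cube-base : α ≢ 0ℤ → ∀ {r} → r ≡ 1 ⊎ r ≡ 3 ⊎ r ≡ 4 ⊎ r ≡ 11 ⊎ r ≡ 12 ⊎ r ≡ 14 → IsCube (g r)
  cube-base α≢0 (inj₁ refl)                             = cube-value α≢0 0 (inj₁ refl) g₁
  cube-base α≢0 (inj₂ (inj₁ refl))                      = cube-value α≢0 1 (inj₂ refl) g₃
  cube-base α≢0 (inj₂ (inj₂ (inj₁ refl)))               = cube-value α≢0 2 (inj₁ refl) g₄
  cube-base α≢0 (inj₂ (inj₂ (inj₂ (inj₁ refl))))        = cube-value α≢0 16 (inj₁ refl) g₁₁
  cube-base α≢0 (inj₂ (inj₂ (inj₂ (inj₂ (inj₁ refl))))) = cube-value α≢0 19 (inj₂ refl) g₁₂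
  cube-base α≢0 (inj₂ (inj₂ (inj₂ (inj₂ (inj₂ refl))))) = cube-value α≢0 26 (inj₁ refl) g₁₄

  squares : α ≢ 0ℤ → ∀ n → (n % 10 ≡ 1 ⊎ n % 10 ≡ 4 ⊎ n % 10 ≡ 6 ⊎ n % 10 ≡ 9) →
            IsSquare (g n)
  squares α≢0 n r = subst (IsSquare ∘ g) (sym (div-mod n 10))
    (along-progression (IsSquare ∘ g) 10 (n % 10) step (square-base α≢0 r) (n / 10))
    where
    step : ∀ m → IsSquare (g m) → IsSquare (g (10 + m))
    step m sq =
      subst IsSquare (sym (square-period m)) (square-scale (^-≢0 α≢0 (4 ℕ.* m + 20)) sq)

  cubes : α ≢ 0ℤ → ∀ n →
          (n % 15 ≡ 1 ⊎ n % 15 ≡ 3 ⊎ n % 15 ≡ 4 ⊎ n % 15 ≡ 11 ⊎ n % 15 ≡ 12 ⊎ n % 15 ≡ 14) →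
          IsCube (g n)
  cubes α≢0 n r = subst (IsCube ∘ g) (sym (div-mod n 15))
    (along-progression (IsCube ∘ g) 15 (n % 15) step (cube-base α≢0 r) (n / 15))
    where
    step : ∀ m → IsCube (g m) → IsCube (g (15 + m))
    step m cb =
      subst IsCube (sym (cube-period m)) (cube-scale (-≢0 (^-≢0 α≢0 (4 ℕ.* m + 30))) cb)

theorem5p3 : (α : ℤ) → α ≢ + 0 →
    ((n : ℕ) → (n % 10 ≡ 1 ⊎ n % 10 ≡ 4 ⊎ n % 10 ≡ 6 ⊎ n % 10 ≡ 9) → IsSquare (h α n))
    × ((n : ℕ) → (n % 15 ≡ 1 ⊎ n % 15 ≡ 3 ⊎ n % 15 ≡ 4 ⊎ n % 15 ≡ 11 ⊎ n % 15 ≡ 12 ⊎ n % 15 ≡ 14) → IsCube (h α n))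
theorem5p3 α α≢0 =
    (λ n r → subst IsSquare (sym (h≡g α≢0 n)) (squares α≢0 n r))
  , (λ n r → subst IsCube (sym (h≡g α≢0 n)) (cubes α≢0 n r))
  where open ClosedForm α
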